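{- Let $f(t)=\sum_{m=0}^{\infty}a_m t^m$ be a formal power series with complex coefficients and let $z$ be an indeterminate. Then, as an identity of formal power series in $z$, $$\sum_{n=0}^{\infty}\frac{(-1)^n}{n!}\left\{\sum_{k=0}^n\binom{n}{k}(-1)^k f(zk)\right\} = \sum_{m=0}^{\infty}a_m b_m z^m,$$ where $b_m=\sum_{k=0}^m S(m,k)$ are the Bell numbers.
   Context: $S(m,k)$ denotes the Stirling numbers of the second kind, $S(m,k)=\frac{(-1)^k}{k!}\sum_{j=0}^k\binom{k}{j}(-1)^j j^m$. The $n$-th term on the left is divisible by $z^n$, so the left side converges coefficientwise. -}

module Defs where


open import Algebra.Bundles using (CommutativeRing)
open import Data.Nat using (ℕ; zero; suc; _≤_; _!)
open import Data.Nat.Combinatorics using (_C_)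
open import Data.Product using (∃)

module _ {c ℓ} (R : CommutativeRing c ℓ) where
  open CommutativeRing R

  ι : ℕ → Carrier
  ι zero = 0#
  ι (suc n) = 1# + ι n

  pow : Carrier → ℕ → Carrier
  pow x zero = 1#
  pow x (suc n) = x * pow x n

  sgn : ℕ → Carrier
  sgn n = pow (- 1#) n

  -- Σ< n f = f 0 + ... + f (n-1);  Σ_{k=0}^n f k = Σ< (suc n) f
  Σ< : ℕ → (ℕ → Carrier) → Carrier
  Σ< zero f = 0#
  Σ< (suc n) f = Σ< n f + f n

  -- "inv is an inverse of n!" for every n (n! invertible in R, e.g. R = ℂ)
  FactInverses : (ℕ → Carrier) → Set ℓ
  FactInverses inv = ∀ n → ι (n !) * inv n ≈ 1#

  PS : Set c
  PS = ℕ → Carrier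

  -- f(c z) : coefficient of z^m is a_m c^m
  dilate : PS → Carrier → PS
  dilate f x m = f m * pow x m

  scale : Carrier → PS → PS
  scale x f m = x * f m

  ΣPS : ℕ → (ℕ → PS) → PS
  ΣPS n F m = Σ< n (λ k → F k m)

  Stirling : (ℕ → Carrier) → ℕ → ℕ → Carrier
  Stirling inv m k =
    sgn k * inv k * Σ< (suc k) (λ j → ι (k C j) * sgn j * pow (ι j) m)

  Bell : (ℕ → Carrier) → ℕ → Carrier
  Bell inv m = Σ< (suc m) (λ k → Stirling inv m k)

  -- n-th term of the left side:
  -- (-1)^n / n! * Σ_{k=0}^n C(n,k) (-1)^k f(zk)
  term : (ℕ → Carrier) → PS → ℕ → PS
  term inv f n =
    scale (sgn n * inv n)
      (ΣPS (suc n) (λ k → scale (ι (n C k) * sgn k) (dilate f (ι k))))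

  -- Σ_{n≥0} F n = g  in the (coefficientwise, discrete) topology of
  -- formal power series: each coefficient of the partial sums is
  -- eventually equal to that of g.
  HasSum : (ℕ → PS) → PS → Set ℓ
  HasSum F g = ∀ m → ∃ λ N → ∀ N′ → N ≤ N′ → ΣPS N′ F m ≈ g m

-- The coefficient of z^m in the n-th term of the left-hand side is
--   a_m · (-1)^n/n! · Σ_{k=0}^n C(n,k) (-1)^k k^m  =  a_m · S(m,n),
-- so the partial sums of the series have m-th coefficient a_m · Σ_{n<N} S(m,n).
-- The whole theorem therefore reduces to the classical fact S(m,n) = 0 for
-- n > m, which we prove with the calculus of forward differences
--   (Δf)(k) = f(k) - f(k+1):
--   * the alternating binomial sum Σ_{k=0}^n C(n,k)(-1)^k f(k) of order n+1
--     equals the one of order n applied to Δf (Pascal's rule), hence it vanishes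
--     whenever Δ^n f vanishes identically;
--   * Δ^{m+1} kills k ↦ k^m, since multiplying by k raises the "degree" by one.
-- Once the Stirling numbers vanish beyond m, the m-th coefficient of the partial
-- sums is constant from N = m+1 on and equals a_m · b_m.  The argument is valid
-- in any commutative ring.
module Submission where

open import Defs
open import Algebra.Bundles using (CommutativeRing)
open import Data.Nat using (ℕ; zero; suc; _≤_; _≤′_; ≤′-refl; ≤′-step) renaming (_+_ to _+ℕ_)
open import Data.Nat.Properties using (≤-refl; ≤⇒≤′; ≤′⇒≤)
open import Data.Nat.Combinatorics using (_C_; nCk+nC[k+1]≡[n+1]C[k+1])
open import Data.Nat.Combinatorics.Specification using (k>n⇒nCk≡0)
open import Data.Product using (_,_)
import Relation.Binary.PropositionalEquality as P

module BellSeries {c ℓ} (R : CommutativeRing c ℓ) where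
  open CommutativeRing R
  open import Algebra.Properties.Ring ring using (-1*x≈-x; -‿distribˡ-*; -‿distribʳ-*; -‿+-comm; -0#≈0#)
  open import Algebra.Solver.Ring.NaturalCoefficients.Default commutativeSemiring
  open import Relation.Binary.Reasoning.Setoid setoid

  Seq : Set c
  Seq = ℕ → Carrier

  Σ-cong : ∀ n {f g : Seq} → (∀ k → f k ≈ g k) → Σ< R n f ≈ Σ< R n g
  Σ-cong zero    f≈g = refl
  Σ-cong (suc n) f≈g = +-cong (Σ-cong n f≈g) (f≈g n)

  Σ-+ : ∀ n (f g : Seq) → Σ< R n (λ k → f k + g k) ≈ Σ< R n f + Σ< R n g
  Σ-+ zero    f g = sym (+-identityʳ 0#)
  Σ-+ (suc n) f g = trans (+-congʳ (Σ-+ n f g))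
    (solve 4 (λ a b c d → (a :+ b) :+ (c :+ d) := (a :+ c) :+ (b :+ d)) refl _ _ _ _)

  Σ-neg : ∀ n (f : Seq) → Σ< R n (λ k → - f k) ≈ - Σ< R n f
  Σ-neg zero    f = sym -0#≈0#
  Σ-neg (suc n) f = trans (+-congʳ (Σ-neg n f)) (-‿+-comm _ _)

  Σ-*ˡ : ∀ n x (f : Seq) → x * Σ< R n f ≈ Σ< R n (λ k → x * f k)
  Σ-*ˡ zero    x f = zeroʳ x
  Σ-*ˡ (suc n) x f = trans (distribˡ x _ _) (+-congʳ (Σ-*ˡ n x f))

  Σ-head : ∀ n (f : Seq) → Σ< R (suc n) f ≈ f 0 + Σ< R n (λ k → f (suc k))
  Σ-head zero    f = trans (+-identityˡ _) (sym (+-identityʳ _))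
  Σ-head (suc n) f = trans (+-congʳ (Σ-head n f)) (+-assoc _ _ _)

  Σ-stable : ∀ {N N′} (f : Seq) → N ≤′ N′ → (∀ n → N ≤ n → f n ≈ 0#) →
             Σ< R N′ f ≈ Σ< R N f
  Σ-stable f ≤′-refl          f≈0 = refl
  Σ-stable f (≤′-step N≤′N′) f≈0 =
    trans (+-cong (Σ-stable f N≤′N′ f≈0) (f≈0 _ (≤′⇒≤ N≤′N′))) (+-identityʳ _)

  -- ι is additive, so it turns Pascal's rule in ℕ into Pascal's rule in R.
  ι-+ : ∀ a b → ι R (a +ℕ b) ≈ ι R a + ι R b
  ι-+ zero    b = sym (+-identityˡ _)
  ι-+ (suc a) b = trans (+-congˡ (ι-+ a b)) (sym (+-assoc _ _ _))

  Δ : Seq → Seq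
  Δ f k = f k - f (suc k)

  DegreeBelow : ℕ → Seq → Set ℓ
  DegreeBelow zero    f = ∀ k → f k ≈ 0#
  DegreeBelow (suc d) f = DegreeBelow d (Δ f)

  degree-cong : ∀ d {f g : Seq} → (∀ k → f k ≈ g k) → DegreeBelow d f → DegreeBelow d g
  degree-cong zero    f≈g f0 k = trans (sym (f≈g k)) (f0 k)
  degree-cong (suc d) f≈g Df   = degree-cong d (λ k → +-cong (f≈g k) (-‿cong (f≈g (suc k)))) Df

  degree-+ : ∀ d {f g : Seq} → DegreeBelow d f → DegreeBelow d g →
             DegreeBelow d (λ k → f k + g k)
  degree-+ zero    f0 g0 k = trans (+-cong (f0 k) (g0 k)) (+-identityʳ 0#)
  degree-+ (suc d) {f} {g} Df Dg = degree-cong d Δ-+ (degree-+ d Df Dg)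
    where
    Δ-+ : ∀ k → Δ f k + Δ g k ≈ Δ (λ k → f k + g k) k
    Δ-+ k = trans
      (solve 4 (λ a b c d → (a :+ b) :+ (c :+ d) := (a :+ c) :+ (b :+ d)) refl
        (f k) (- f (suc k)) (g k) (- g (suc k)))
      (+-congˡ (-‿+-comm _ _))

  degree-neg : ∀ d {f : Seq} → DegreeBelow d f → DegreeBelow d (λ k → - f k)
  degree-neg zero    f0 k = trans (-‿cong (f0 k)) -0#≈0#
  degree-neg (suc d) Df   = degree-cong d (λ k → sym (-‿+-comm _ _)) (degree-neg d Df)

  degree-shift : ∀ d {f : Seq} → DegreeBelow d f → DegreeBelow d (λ k → f (suc k))
  degree-shift zero    f0 k = f0 (suc k)
  degree-shift (suc d) Df   = degree-shift d Df

  degree-step : ∀ d {f : Seq} → DegreeBelow d f → DegreeBelow (suc d) f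
  degree-step zero    f0 k = trans (+-cong (f0 k) (trans (-‿cong (f0 (suc k))) -0#≈0#)) (+-identityʳ 0#)
  degree-step (suc d) Df   = degree-step d Df

  degree-weaken : ∀ {d e} {f : Seq} → d ≤′ e → DegreeBelow d f → DegreeBelow e f
  degree-weaken ≤′-refl        Df = Df
  degree-weaken {f = f} (≤′-step {n} d≤′e) Df = degree-step n {f} (degree-weaken d≤′e Df)

  -- Multiplication by k raises the degree by one, because of the product rule
  --   Δ(k·g)(k) = k·(Δg)(k) - g(k+1).
  degree-*ι : ∀ d {g : Seq} → DegreeBelow d g → DegreeBelow (suc d) (λ k → ι R k * g k)
  degree-*ι zero    {g} g0 = degree-step 0 (λ k → trans (*-congˡ (g0 k)) (zeroʳ _))
  degree-*ι (suc d) {g} Dg = degree-cong (suc d) product-rule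
      (degree-+ (suc d) (degree-*ι d Dg) (degree-neg (suc d) (degree-shift (suc d) {g} Dg)))
    where
    product-rule : ∀ k → ι R k * Δ g k - g (suc k) ≈ Δ (λ k → ι R k * g k) k
    product-rule k = begin
      ι R k * (g k - g (suc k)) - g (suc k)
        ≈⟨ solve 3 (λ a x ny → a :* (x :+ ny) :+ ny := a :* x :+ (con 1 :+ a) :* ny) refl
             (ι R k) (g k) (- g (suc k)) ⟩
      ι R k * g k + (1# + ι R k) * - g (suc k)
        ≈⟨ +-congˡ (sym (-‿distribʳ-* _ _)) ⟩
      ι R k * g k - (1# + ι R k) * g (suc k) ∎

  degree-pow : ∀ m → DegreeBelow (suc m) (λ k → pow R (ι R k) m)
  degree-pow zero    k = -‿inverseʳ 1#
  degree-pow (suc m)   = degree-*ι (suc m) (degree-pow m)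

  binomialTerm : ℕ → Seq → Seq
  binomialTerm n f k = ι R (n C k) * sgn R k * f k

  ∇ : ℕ → Seq → Carrier
  ∇ n f = Σ< R (suc n) (binomialTerm n f)

  ∇-linear : ∀ n (f g : Seq) → ∇ n (λ k → f k - g k) ≈ ∇ n f - ∇ n g
  ∇-linear n f g = begin
    Σ< R (suc n) (λ k → ι R (n C k) * sgn R k * (f k - g k))
      ≈⟨ Σ-cong (suc n) (λ k → trans (distribˡ _ _ _) (+-congˡ (sym (-‿distribʳ-* _ _)))) ⟩
    Σ< R (suc n) (λ k → binomialTerm n f k - binomialTerm n g k)
      ≈⟨ trans (Σ-+ (suc n) _ _) (+-congˡ (Σ-neg (suc n) _)) ⟩
    ∇ n f - ∇ n g ∎

  -- Pascal's rule splits the order-(n+1) sum into the order-n sums of f and of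
  -- its shift:  ∇ (n+1) f = ∇ n f - ∇ n (f ∘ suc).
  ∇-step : ∀ n (f : Seq) → ∇ (suc n) f ≈ ∇ n f - ∇ n (λ k → f (suc k))
  ∇-step n f = begin
    ∇ (suc n) f
      ≈⟨ Σ-head (suc n) _ ⟩
    binomialTerm (suc n) f 0 + Σ< R (suc n) (λ j → binomialTerm (suc n) f (suc j))
      ≈⟨ +-congˡ (trans (Σ-cong (suc n) pascal) (Σ-+ (suc n) _ _)) ⟩
    binomialTerm n f 0 + (Σ< R (suc n) (λ j → binomialTerm n f (suc j)) + Shifted)
      ≈⟨ sym (+-assoc _ _ _) ⟩
    (binomialTerm n f 0 + Σ< R (suc n) (λ j → binomialTerm n f (suc j))) + Shifted
      ≈⟨ +-cong (trans (sym (Σ-head (suc n) _)) top-vanishes) shifted ⟩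
    ∇ n f - ∇ n (λ k → f (suc k)) ∎
    where
    Shifted : Carrier
    Shifted = Σ< R (suc n) (λ j → ι R (n C j) * sgn R (suc j) * f (suc j))

    pascal : ∀ j → binomialTerm (suc n) f (suc j) ≈
                   binomialTerm n f (suc j) + ι R (n C j) * sgn R (suc j) * f (suc j)
    pascal j = begin
      ι R (suc n C suc j) * sgn R (suc j) * f (suc j)
        ≈⟨ *-congʳ (*-congʳ (reflexive (P.cong (ι R) (P.sym (nCk+nC[k+1]≡[n+1]C[k+1] n j))))) ⟩
      ι R (n C j +ℕ n C suc j) * sgn R (suc j) * f (suc j)
        ≈⟨ *-congʳ (*-congʳ (ι-+ (n C j) (n C suc j))) ⟩
      (ι R (n C j) + ι R (n C suc j)) * sgn R (suc j) * f (suc j)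
        ≈⟨ solve 4 (λ a b s x → (a :+ b) :* s :* x := b :* s :* x :+ a :* s :* x) refl _ _ _ _ ⟩
      binomialTerm n f (suc j) + ι R (n C j) * sgn R (suc j) * f (suc j) ∎

    -- The extra summand C(n, n+1) (-1)^(n+1) f(n+1) is zero.
    top-vanishes : Σ< R (suc (suc n)) (binomialTerm n f) ≈ ∇ n f
    top-vanishes = begin
      ∇ n f + ι R (n C suc n) * sgn R (suc n) * f (suc n)
        ≈⟨ +-congˡ (*-congʳ (*-congʳ (reflexive (P.cong (ι R) (k>n⇒nCk≡0 {n} {suc n} ≤-refl))))) ⟩
      ∇ n f + 0# * sgn R (suc n) * f (suc n)
        ≈⟨ +-congˡ (trans (*-congʳ (zeroˡ _)) (zeroˡ _)) ⟩
      ∇ n f + 0#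
        ≈⟨ +-identityʳ _ ⟩
      ∇ n f ∎

    shifted : Shifted ≈ - ∇ n (λ k → f (suc k))
    shifted = trans (Σ-cong (suc n) sign-out) (Σ-neg (suc n) _)
      where
      sign-out : ∀ j → ι R (n C j) * sgn R (suc j) * f (suc j) ≈ - binomialTerm n (λ k → f (suc k)) j
      sign-out j = begin
        ι R (n C j) * (- 1# * sgn R j) * f (suc j)
          ≈⟨ *-congʳ (*-congˡ (-1*x≈-x _)) ⟩
        ι R (n C j) * - sgn R j * f (suc j)
          ≈⟨ *-congʳ (sym (-‿distribʳ-* _ _)) ⟩
        - (ι R (n C j) * sgn R j) * f (suc j)
          ≈⟨ sym (-‿distribˡ-* _ _) ⟩
        - binomialTerm n (λ k → f (suc k)) j ∎

  ∇-Δ : ∀ n (f : Seq) → ∇ (suc n) f ≈ ∇ n (Δ f)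
  ∇-Δ n f = trans (∇-step n f) (sym (∇-linear n f (λ k → f (suc k))))

  ∇-vanishes : ∀ n (f : Seq) → DegreeBelow n f → ∇ n f ≈ 0#
  ∇-vanishes zero    f f0 = trans (+-identityˡ _) (trans (*-congˡ (f0 0)) (zeroʳ _))
  ∇-vanishes (suc n) f Df = trans (∇-Δ n f) (∇-vanishes n (Δ f) Df)

  module _ (inv : ℕ → Carrier) where

    stirling-vanishes : ∀ m n → suc m ≤ n → Stirling R inv m n ≈ 0#
    stirling-vanishes m n m<n = trans
      (*-congˡ (∇-vanishes n _ (degree-weaken (≤⇒≤′ m<n) (degree-pow m))))
      (zeroʳ _)

    term-coefficient : ∀ (a : PS R) m n → term R inv a n m ≈ a m * Stirling R inv m n
    term-coefficient a m n = begin
      (sgn R n * inv n) * Σ< R (suc n) (λ k → (ι R (n C k) * sgn R k) * (a m * pow R (ι R k) m))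
        ≈⟨ *-congˡ (Σ-cong (suc n) (λ k →
             solve 4 (λ c s x p → (c :* s) :* (x :* p) := x :* (c :* s :* p)) refl _ _ _ _)) ⟩
      (sgn R n * inv n) * Σ< R (suc n) (λ k → a m * binomialTerm n (λ k → pow R (ι R k) m) k)
        ≈⟨ *-congˡ (sym (Σ-*ˡ (suc n) (a m) _)) ⟩
      (sgn R n * inv n) * (a m * ∇ n (λ k → pow R (ι R k) m))
        ≈⟨ solve 4 (λ s i x y → (s :* i) :* (x :* y) := x :* (s :* i :* y)) refl _ _ _ _ ⟩
      a m * Stirling R inv m n ∎

corollary1 : ∀ {c ℓ} (R : CommutativeRing c ℓ) (inv : ℕ → CommutativeRing.Carrier R)
    → FactInverses R inv
    → (a : PS R)
    → HasSum R (term R inv a)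
    (λ m → CommutativeRing._*_ R (a m) (Bell R inv m))
corollary1 R inv _ a m = suc m , λ N N≥m+1 → begin
    Σ< R N (λ n → term R inv a n m)
      ≈⟨ Σ-cong N (term-coefficient inv a m) ⟩
    Σ< R N (λ n → a m * Stirling R inv m n)
      ≈⟨ sym (Σ-*ˡ N (a m) _) ⟩
    a m * Σ< R N (Stirling R inv m)
      ≈⟨ *-congˡ (Σ-stable _ (≤⇒≤′ N≥m+1) (stirling-vanishes inv m)) ⟩
    a m * Bell R inv m ∎
  where
  open CommutativeRing R
  open BellSeries R
  open import Relation.Binary.Reasoning.Setoid setoid
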